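{- Let $\mathcal{D}=(D,Q)$ be a discriminant form and $\gamma\in D$. Let $H_0,\dots,H_n$ be a sequence of $n+1$ nicely orthogonal isotropic subgroups for $\gamma$. Then $\mathfrak{e}_\gamma$ lies in the image of the restriction of $\uparrow=\sum_{i=0}^n\uparrow_{H_i}$ to $\bigoplus_{i=0}^n\mathbb{C}[H_i^\perp/H_i]$; in particular $\mathfrak{e}_\gamma$ lies in the image of $\sum_H\uparrow_H$ where $H$ runs over all isotropic subgroups of $D$.
   Context: Discriminant form $\mathcal{D}=(D,Q)$: finite abelian group, $Q:D\to\mathbb{Q}/\mathbb{Z}$, $Q(a\gamma)=a^2Q(\gamma)$, nondegenerate bilinear $(\gamma,\delta)=Q(\gamma+\delta)-Q(\gamma)-Q(\delta)$. A subgroup $H$ is isotropic if $Q(H)=0$; $H^\perp=\{\delta:(\delta,h)=0\ \forall h\in H\}$. $\mathbb{C}[D]$ has basis $(\mathfrak{e}_\gamma)$; $\uparrow_H:\mathbb{C}[H^\perp/H]\to\mathbb{C}[D]$ is the linear map $\mathfrak{e}_\alpha\mapsto\sum_{\delta\in\alpha}\mathfrak{e}_\delta$. A sequence $H_0,\dots,H_n$ of isotropic subgroups is a sequence of $n+1$ nicely orthogonal isotropic subgroups if: (a) $H_i\perp H_j$ for all $i\neq j$; (b) $H_0+(H_i\setminus\{0\})\subseteq\bigcup_{k=1}^nH_k$ for all $i=1,\dots,n$; (c) every $H_i$ is cyclic, $H_i=\langle\gamma_i\rangle$, and $|H_i|=n$ for $i=0,\dots,n$; (d) for all $i\neq j$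 in $\{0,\dots,n\}$, whenever $a,b\in\mathbb{Z}$ satisfy $a\gamma_i=b\gamma_j$ then $a\gamma_i=b\gamma_j=0$. It is a sequence for $\gamma$ if moreover $\gamma\in H_i^\perp$ for all $i=0,\dots,n$. -}

module Defs where

open import Level using (0ℓ)
open import Data.Nat using (ℕ; zero; suc; _<_)
open import Data.Integer as ℤ using (ℤ; +_; -[1+_])
open import Data.Rational as ℚ using (ℚ; _/_; _+_; _-_; _*_; 0ℚ; 1ℚ)
open import Data.Fin using (Fin; zero; suc)
open import Data.List using (List; []; _∷_; upTo)
open import Data.List.Relation.Unary.All using (All)
open import Data.List.Membership.Propositional using (_∈_)
open import Data.Product using (Σ; ∃; ∃-syntax; _×_; _,_)
open import Relation.Binary.PropositionalEquality using (_≡_)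
open import Relation.Nullary using (¬_; Dec; yes; no)

-- Equality in ℚ/ℤ: two rationals are congruent modulo ℤ.
_≈ℤ_ : ℚ → ℚ → Set
x ≈ℤ y = ∃[ k ] (x - y ≡ k / 1)

record FinAbGroup : Set₁ where
  infixl 6 _⊕_
  field
    D      : Set
    _⊕_    : D → D → D
    𝟘      : D
    ⊖_     : D → D
    ⊕-assoc   : ∀ x y z → (x ⊕ y) ⊕ z ≡ x ⊕ (y ⊕ z)
    ⊕-comm    : ∀ x y → x ⊕ y ≡ y ⊕ x
    ⊕-identityˡ : ∀ x → 𝟘 ⊕ x ≡ x
    ⊕-inverseˡ  : ∀ x → (⊖ x) ⊕ x ≡ 𝟘
    _≟_    : (x y : D) → Dec (x ≡ y)
    elems  : List D
    elems-complete : ∀ x → x ∈ elems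

module FinAbGroupOps (G : FinAbGroup) where
  open FinAbGroup G

  _·ℕ_ : ℕ → D → D
  zero  ·ℕ x = 𝟘
  suc m ·ℕ x = x ⊕ (m ·ℕ x)

  infixr 7 _·_
  _·_ : ℤ → D → D
  (+ m)    · x = m ·ℕ x
  -[1+ m ] · x = ⊖ (suc m ·ℕ x)

  bil : (D → ℚ) → D → D → ℚ
  bil Q x y = Q (x ⊕ y) - Q x - Q y

record DiscriminantForm : Set₁ where
  field
    grp : FinAbGroup
  open FinAbGroup grp
  open FinAbGroupOps grp
  field
    Q : D → ℚ
    Q-quad : ∀ (a : ℤ) x → Q (a · x) ≈ℤ (((a ℤ.* a) / 1) * Q x)
    bilinear : ∀ x x' y → bil Q (x ⊕ x') y ≈ℤ (bil Q x y + bil Q x' y)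
    nondegenerate : ∀ x → (∀ y → bil Q x y ≈ℤ 0ℚ) → x ≡ 𝟘

module _ (𝒟 : DiscriminantForm) where
  open DiscriminantForm 𝒟
  open FinAbGroup grp
  open FinAbGroupOps grp

  ⟪_,_⟫ : D → D → ℚ
  ⟪ x , y ⟫ = bil Q x y

  _∈⟨_⟩ : D → D → Set
  x ∈⟨ g ⟩ = ∃[ a ] (x ≡ a · g)

  _∈⟨_⟩⊥ : D → D → Set
  x ∈⟨ g ⟩⊥ = ∀ (a : ℤ) → ⟪ x , a · g ⟫ ≈ℤ 0ℚ

  IsotropicGen : D → Set
  IsotropicGen g = ∀ (a : ℤ) → Q (a · g) ≈ℤ 0ℚ

  HasOrder : D → ℕ → Set
  HasOrder g n = (0 < n) × ((+ n) · g ≡ 𝟘) × (∀ k → 0 < k → k < n → ¬ ((+ k) · g ≡ 𝟘))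

  -- H_0,…,H_n (H_i = ⟨gs i⟩) is a sequence of n+1 nicely orthogonal
  -- isotropic subgroups
  record NicelyOrthogonal (n : ℕ) (gs : Fin (suc n) → D) : Set where
    field
      isotropic : ∀ i → IsotropicGen (gs i)
      -- (a) H_i ⊥ H_j for i ≠ j
      orth : ∀ i j → ¬ i ≡ j → ∀ (a b : ℤ) → ⟪ a · gs i , b · gs j ⟫ ≈ℤ 0ℚ
      -- (b) H_0 + (H_i ∖ {0}) ⊆ H_1 ∪ … ∪ H_n for i = 1..n
      cover : ∀ (i : Fin n) (a b : ℤ) → ¬ (b · gs (suc i) ≡ 𝟘) →
              ∃[ k ] ((a · gs zero ⊕ b · gs (suc i)) ∈⟨ gs (suc k) ⟩)
      order : ∀ i → HasOrder (gs i) n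
      -- (d) a γ_i = b γ_j ⇒ a γ_i = b γ_j = 0
      trivialInter : ∀ i j → ¬ i ≡ j → ∀ (a b : ℤ) → a · gs i ≡ b · gs j →
                     (a · gs i ≡ 𝟘) × (b · gs j ≡ 𝟘)

  -- ℂ[D] is modelled with rational coefficients: vectors D → ℚ
  𝔢 : D → D → ℚ
  𝔢 x y with x ≟ y
  ... | yes _ = 1ℚ
  ... | no  _ = 0ℚ

  sumℕ : ℕ → (ℕ → ℚ) → ℚ
  sumℕ zero    f = 0ℚ
  sumℕ (suc m) f = sumℕ m f + f m

  sumFin : ∀ {m} → (Fin m → ℚ) → ℚ
  sumFin {zero}  f = 0ℚ
  sumFin {suc m} f = f zero + sumFin (λ i → f (suc i))

  -- ↑_{⟨g⟩}(𝔢_{δ+⟨g⟩}) = Σ_{x ∈ δ+⟨g⟩} 𝔢_x, where g has order n, so the coset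
  -- δ+⟨g⟩ is enumerated without repetition as δ + a·g, a = 0,…,n-1.
  ↑coset : ℕ → D → D → (D → ℚ)
  ↑coset n g δ y = sumℕ n (λ a → 𝔢 (δ ⊕ (+ a) · g) y)

  -- an element of ℂ[⟨g⟩^⊥/⟨g⟩] as a formal combination Σ c·𝔢_{δ+⟨g⟩},
  -- δ a representative in ⟨g⟩^⊥; ↑ of it:
  ↑H : ℕ → D → List (ℚ × D) → (D → ℚ)
  ↑H n g []             y = 0ℚ
  ↑H n g ((c , δ) ∷ cs) y = c * ↑coset n g δ y + ↑H n g cs y

  ValidElt : D → List (ℚ × D) → Set
  ValidElt g cs = All (λ p → Data.Product.proj₂ p ∈⟨ g ⟩⊥) cs

{-# OPTIONS --safe #-}
module Submission where

-- Put W = (H₁ ∪ … ∪ Hₙ) ∖ {0}. By (d) the sets Hₖ ∖ {0} are disjoint, so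
-- Σₖ ↑_{Hₖ}(𝔢_{γ+Hₖ}) = n·𝔢_γ + 𝟙_{γ+W}. By (b) and (d), W is a union of cosets of H₀,
-- so ↑_{H₀}(Σ_{w∈W} 𝔢_{γ+w+H₀}) = n·𝟙_{γ+W}, and γ + w ∈ H₀^⊥ by (a). Hence
-- 𝔢_γ = (1/n) Σₖ ↑_{Hₖ}(𝔢_{γ+Hₖ}) − (1/n²) ↑_{H₀}(Σ_{w∈W} 𝔢_{γ+w+H₀}).

open import Defs
open import Data.Empty using (⊥-elim)
open import Data.Fin as Fin using (Fin; zero; suc; toℕ; fromℕ<)
import Data.Fin.Properties as Finₚ
open import Data.Integer as ℤ using (ℤ; -[1+_])
import Data.Integer.Properties as ℤₚ
open import Data.List using (List; []; _∷_; _++_; concat; tabulate)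
open import Data.List.Relation.Unary.All using ([]; _∷_)
open import Data.List.Relation.Unary.All.Properties using (concat⁺; tabulate⁺)
open import Data.Nat as ℕ using (ℕ; zero; suc; _∸_)
open import Data.Nat.DivMod using (_%_; _/_; m≡m%n+[m/n]*n; m%n<n)
import Data.Nat.Properties as ℕₚ
open import Data.Product using (Σ; ∃; ∃-syntax; _×_; _,_; proj₁; proj₂)
open import Data.Rational as ℚ using (ℚ; _+_; _-_; _*_; -_; 0ℚ; 1ℚ; 1/_)
import Data.Rational.Properties as ℚₚ
import Data.Rational.Unnormalised as ℚᵘ
import Data.Rational.Unnormalised.Properties as ℚᵘₚ
open import Data.Rational.Solver using (module +-*-Solver)
open import Relation.Binary.Definitions using (tri<; tri≈; tri>)
open import Relation.Binary.PropositionalEquality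
open import Relation.Nullary using (¬_; Dec; yes; no)
open import Relation.Nullary.Decidable using (from-yes)

open +-*-Solver

/1-homo-+ : ∀ a b → (a ℚ./ 1) + (b ℚ./ 1) ≡ (a ℤ.+ b) ℚ./ 1
/1-homo-+ a b = ℚₚ.toℚᵘ-injective (begin
  ℚ.toℚᵘ (a ℚ./ 1 + b ℚ./ 1)                 ≈⟨ ℚₚ.toℚᵘ-homo-+ (a ℚ./ 1) (b ℚ./ 1) ⟩
  ℚ.toℚᵘ (a ℚ./ 1) ℚᵘ.+ ℚ.toℚᵘ (b ℚ./ 1)
    ≈⟨ ℚᵘₚ.+-cong (ℚₚ.toℚᵘ-fromℚᵘ (ℚᵘ.mkℚᵘ a 0)) (ℚₚ.toℚᵘ-fromℚᵘ (ℚᵘ.mkℚᵘ b 0)) ⟩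
  ℚᵘ.mkℚᵘ a 0 ℚᵘ.+ ℚᵘ.mkℚᵘ b 0              ≈⟨ ℚᵘ.*≡* cross ⟩
  ℚᵘ.mkℚᵘ (a ℤ.+ b) 0                        ≈⟨ ℚᵘₚ.≃-sym (ℚₚ.toℚᵘ-fromℚᵘ (ℚᵘ.mkℚᵘ (a ℤ.+ b) 0)) ⟩
  ℚ.toℚᵘ ((a ℤ.+ b) ℚ./ 1)                   ∎)
  where
  open ℚᵘₚ.≃-Reasoning
  cross : (a ℤ.* ℤ.+ 1 ℤ.+ b ℤ.* ℤ.+ 1) ℤ.* ℤ.+ 1 ≡ (a ℤ.+ b) ℤ.* (ℤ.+ 1 ℤ.* ℤ.+ 1)
  cross rewrite ℤₚ.*-identityʳ a | ℤₚ.*-identityʳ b | ℤₚ.*-identityʳ (a ℤ.+ b) = refl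

≈ℤ-zero-if-sum : ∀ p u v → p ≈ℤ (u + v) → u ≈ℤ 0ℚ → v ≈ℤ 0ℚ → p ≈ℤ 0ℚ
≈ℤ-zero-if-sum p u v (k₁ , p-u-v) (k₂ , u-0) (k₃ , v-0) = k₁ ℤ.+ k₂ ℤ.+ k₃ , (begin
  p - 0ℚ
    ≡⟨ solve 3 (λ p u v → p :- con 0ℚ := ((p :- (u :+ v)) :+ (u :- con 0ℚ)) :+ (v :- con 0ℚ)) refl p u v ⟩
  ((p - (u + v)) + (u - 0ℚ)) + (v - 0ℚ)       ≡⟨ cong₂ _+_ (cong₂ _+_ p-u-v u-0) v-0 ⟩
  (k₁ ℚ./ 1 + k₂ ℚ./ 1) + k₃ ℚ./ 1            ≡⟨ cong (_+ k₃ ℚ./ 1) (/1-homo-+ k₁ k₂) ⟩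
  (k₁ ℤ.+ k₂) ℚ./ 1 + k₃ ℚ./ 1                ≡⟨ /1-homo-+ (k₁ ℤ.+ k₂) k₃ ⟩
  (k₁ ℤ.+ k₂ ℤ.+ k₃) ℚ./ 1                    ∎)
  where open ≡-Reasoning

-- The coefficients 1/N and -1/N² of the witness make the two contributions of W cancel.
cancel-witness-coefficients : ∀ N ι e w → N * ι ≡ 1ℚ →
  (- (ι * ι)) * (N * w) + ι * (N * e + w) ≡ e
cancel-witness-coefficients N ι e w Nι≡1 = begin
  (- (ι * ι)) * (N * w) + ι * (N * e + w)
    ≡⟨ solve 4 (λ N ι e w → (:- (ι :* ι)) :* (N :* w) :+ ι :* (N :* e :+ w) := (N :* ι) :* e :+ (ι :* w) :* (con 1ℚ :- N :* ι)) refl N ι e w ⟩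
  (N * ι) * e + (ι * w) * (1ℚ - N * ι)        ≡⟨ cong (λ t → t * e + (ι * w) * (1ℚ - t)) Nι≡1 ⟩
  1ℚ * e + (ι * w) * (1ℚ - 1ℚ)
    ≡⟨ solve 2 (λ e t → con 1ℚ :* e :+ t :* (con 1ℚ :- con 1ℚ) := e) refl e (ι * w) ⟩
  e                                           ∎
  where open ≡-Reasoning

module FiniteSums (𝒟 : DiscriminantForm) where
  open ≡-Reasoning

  sumℕ-suc : ∀ m f → sumℕ 𝒟 (suc m) f ≡ f 0 + sumℕ 𝒟 m (λ j → f (suc j))
  sumℕ-suc zero    f = trans (ℚₚ.+-identityˡ (f 0)) (sym (ℚₚ.+-identityʳ (f 0)))
  sumℕ-suc (suc m) f = begin
    sumℕ 𝒟 (suc m) f + f (suc m)                          ≡⟨ cong (_+ f (suc m)) (sumℕ-suc m f) ⟩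
    (f 0 + sumℕ 𝒟 m (λ j → f (suc j))) + f (suc m)       ≡⟨ ℚₚ.+-assoc (f 0) _ _ ⟩
    f 0 + sumℕ 𝒟 (suc m) (λ j → f (suc j))               ∎

  sumℕ≡sumFin : ∀ m f → sumℕ 𝒟 m f ≡ sumFin 𝒟 {m} (λ i → f (toℕ i))
  sumℕ≡sumFin zero    f = refl
  sumℕ≡sumFin (suc m) f = trans (sumℕ-suc m f) (cong (_+_ (f 0)) (sumℕ≡sumFin m (λ j → f (suc j))))

  sumFin-cong : ∀ {n} {f g : Fin n → ℚ} → (∀ i → f i ≡ g i) → sumFin 𝒟 f ≡ sumFin 𝒟 g
  sumFin-cong {zero}  f≗g = refl
  sumFin-cong {suc n} f≗g = cong₂ _+_ (f≗g zero) (sumFin-cong (λ i → f≗g (suc i)))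

  sumFin-distrib-+ : ∀ {n} (f g : Fin n → ℚ) → sumFin 𝒟 (λ i → f i + g i) ≡ sumFin 𝒟 f + sumFin 𝒟 g
  sumFin-distrib-+ {zero}  f g = refl
  sumFin-distrib-+ {suc n} f g = begin
    (f zero + g zero) + sumFin 𝒟 (λ i → f (suc i) + g (suc i))
      ≡⟨ cong ((f zero + g zero) +_) (sumFin-distrib-+ (λ i → f (suc i)) (λ i → g (suc i))) ⟩
    (f zero + g zero) + (F + G)
      ≡⟨ solve 4 (λ a b c d → (a :+ b) :+ (c :+ d) := (a :+ c) :+ (b :+ d)) refl (f zero) (g zero) F G ⟩
    (f zero + F) + (g zero + G)                                   ∎
    where
    F = sumFin 𝒟 (λ i → f (suc i))
    G = sumFin 𝒟 (λ i → g (suc i))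

  sumFin-distribˡ-* : ∀ {n} c (f : Fin n → ℚ) → sumFin 𝒟 (λ i → c * f i) ≡ c * sumFin 𝒟 f
  sumFin-distribˡ-* {zero}  c f = sym (ℚₚ.*-zeroʳ c)
  sumFin-distribˡ-* {suc n} c f =
    trans (cong (_+_ (c * f zero)) (sumFin-distribˡ-* c (λ i → f (suc i)))) (sym (ℚₚ.*-distribˡ-+ c _ _))

  sumFin-zero : ∀ {n} (f : Fin n → ℚ) → (∀ i → f i ≡ 0ℚ) → sumFin 𝒟 f ≡ 0ℚ
  sumFin-zero {zero}  f f≗0 = refl
  sumFin-zero {suc n} f f≗0 = cong₂ _+_ (f≗0 zero) (sumFin-zero (λ i → f (suc i)) (λ i → f≗0 (suc i)))

  sumFin-const : ∀ n c → sumFin 𝒟 {n} (λ _ → c) ≡ sumFin 𝒟 {n} (λ _ → 1ℚ) * c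
  sumFin-const n c = begin
    sumFin 𝒟 {n} (λ _ → c)          ≡⟨ sumFin-cong {n} (λ _ → sym (ℚₚ.*-identityʳ c)) ⟩
    sumFin 𝒟 {n} (λ _ → c * 1ℚ)     ≡⟨ sumFin-distribˡ-* {n} c (λ _ → 1ℚ) ⟩
    c * sumFin 𝒟 {n} (λ _ → 1ℚ)     ≡⟨ ℚₚ.*-comm c _ ⟩
    sumFin 𝒟 {n} (λ _ → 1ℚ) * c     ∎

  sumFin-single : ∀ {n} (f : Fin n → ℚ) i₀ → (∀ i → ¬ i ≡ i₀ → f i ≡ 0ℚ) → sumFin 𝒟 f ≡ f i₀
  sumFin-single f zero f≗0 =
    trans (cong (_+_ (f zero)) (sumFin-zero _ (λ i → f≗0 (suc i) (λ ())))) (ℚₚ.+-identityʳ _)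
  sumFin-single f (suc i₀) f≗0 =
    trans (cong₂ _+_ (f≗0 zero (λ ())) (sumFin-single (λ i → f (suc i)) i₀ (λ i i≢i₀ → f≗0 (suc i) (λ { refl → i≢i₀ refl }))))
          (ℚₚ.+-identityˡ _)

  sumFin-swap : ∀ {m n} (f : Fin m → Fin n → ℚ) →
                sumFin 𝒟 (λ i → sumFin 𝒟 (λ j → f i j)) ≡ sumFin 𝒟 (λ j → sumFin 𝒟 (λ i → f i j))
  sumFin-swap {zero} {n} f = sym (sumFin-zero {n} _ (λ _ → refl))
  sumFin-swap {suc m} f =
    trans (cong (_+_ (sumFin 𝒟 (f zero))) (sumFin-swap (λ i → f (suc i))))
          (sym (sumFin-distrib-+ (f zero) _))

  sumFin-ones-positive : ∀ n → 0ℚ ℚ.< sumFin 𝒟 {suc n} (λ _ → 1ℚ)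
  sumFin-ones-positive n = ℚₚ.+-mono-<-≤ (from-yes (0ℚ ℚₚ.<? 1ℚ)) (nonNegative n)
    where
    nonNegative : ∀ n → 0ℚ ℚ.≤ sumFin 𝒟 {n} (λ _ → 1ℚ)
    nonNegative zero    = ℚₚ.≤-refl
    nonNegative (suc n) = ℚₚ.+-mono-≤ (from-yes (0ℚ ℚₚ.≤? 1ℚ)) (nonNegative n)

module AbelianGroupProperties (G : FinAbGroup) where
  open FinAbGroup G
  open FinAbGroupOps G

  ⊕-identityʳ : ∀ x → x ⊕ 𝟘 ≡ x
  ⊕-identityʳ x = trans (⊕-comm x 𝟘) (⊕-identityˡ x)

  ⊕-inverseʳ : ∀ x → x ⊕ ⊖ x ≡ 𝟘
  ⊕-inverseʳ x = trans (⊕-comm x (⊖ x)) (⊕-inverseˡ x)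

  ⊖-cancelˡ : ∀ x y → ⊖ x ⊕ (x ⊕ y) ≡ y
  ⊖-cancelˡ x y = trans (sym (⊕-assoc (⊖ x) x y)) (trans (cong (_⊕ y) (⊕-inverseˡ x)) (⊕-identityˡ y))

  ⊕-cancelˡ : ∀ x y → x ⊕ (⊖ x ⊕ y) ≡ y
  ⊕-cancelˡ x y = trans (sym (⊕-assoc x (⊖ x) y)) (trans (cong (_⊕ y) (⊕-inverseʳ x)) (⊕-identityˡ y))

  x⊕y≡z⇒y≡⊖x⊕z : ∀ {x y z} → x ⊕ y ≡ z → y ≡ ⊖ x ⊕ z
  x⊕y≡z⇒y≡⊖x⊕z {x} {y} x⊕y≡z = trans (sym (⊖-cancelˡ x y)) (cong (⊖ x ⊕_) x⊕y≡z)

  inverse-unique : ∀ {x y} → x ⊕ y ≡ 𝟘 → y ≡ ⊖ x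
  inverse-unique {x} x⊕y≡𝟘 = trans (x⊕y≡z⇒y≡⊖x⊕z x⊕y≡𝟘) (⊕-identityʳ (⊖ x))

  x⊕y≡y⇒x≡𝟘 : ∀ {x y} → x ⊕ y ≡ y → x ≡ 𝟘
  x⊕y≡y⇒x≡𝟘 {x} {y} x⊕y≡y = trans (x⊕y≡z⇒y≡⊖x⊕z (trans (⊕-comm y x) x⊕y≡y)) (⊕-inverseˡ y)

  ·ℕ-distribʳ-+ : ∀ a b x → (a ℕ.+ b) ·ℕ x ≡ a ·ℕ x ⊕ b ·ℕ x
  ·ℕ-distribʳ-+ zero    b x = sym (⊕-identityˡ _)
  ·ℕ-distribʳ-+ (suc a) b x = trans (cong (x ⊕_) (·ℕ-distribʳ-+ a b x)) (sym (⊕-assoc x _ _))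

  ⊖-· : ∀ a x → ⊖ (a · x) ≡ (ℤ.- a) · x
  ⊖-· (ℤ.+ zero)  x = sym (inverse-unique (⊕-identityˡ 𝟘))
  ⊖-· (ℤ.+ suc a) x = refl
  ⊖-· -[1+ a ]    x = sym (inverse-unique (⊕-inverseˡ (suc a ·ℕ x)))

module ElementOfFiniteOrder (𝒟 : DiscriminantForm) where
  open DiscriminantForm 𝒟
  open FinAbGroup grp
  open FinAbGroupOps grp
  open AbelianGroupProperties grp

  module _ {g n} (g-order : HasOrder 𝒟 g n) where
    private
      instance
        n≢0 : ℕ.NonZero n
        n≢0 = ℕ.>-nonZero (proj₁ g-order)

      n·g≡𝟘 : n ·ℕ g ≡ 𝟘
      n·g≡𝟘 = proj₁ (proj₂ g-order)

    ·ℕ-nonzero : ∀ k → 0 ℕ.< k → k ℕ.< n → ¬ k ·ℕ g ≡ 𝟘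
    ·ℕ-nonzero = proj₂ (proj₂ g-order)

    ·ℕ-multiple-of-order : ∀ q → (q ℕ.* n) ·ℕ g ≡ 𝟘
    ·ℕ-multiple-of-order zero    = refl
    ·ℕ-multiple-of-order (suc q) =
      trans (·ℕ-distribʳ-+ n (q ℕ.* n) g) (trans (cong₂ _⊕_ n·g≡𝟘 (·ℕ-multiple-of-order q)) (⊕-identityˡ 𝟘))

    ·ℕ-mod : ∀ k → k ·ℕ g ≡ (k % n) ·ℕ g
    ·ℕ-mod k = begin
      k ·ℕ g                                    ≡⟨ cong (_·ℕ g) (m≡m%n+[m/n]*n k n) ⟩
      (k % n ℕ.+ (k / n) ℕ.* n) ·ℕ g            ≡⟨ ·ℕ-distribʳ-+ (k % n) _ g ⟩
      (k % n) ·ℕ g ⊕ ((k / n) ℕ.* n) ·ℕ g       ≡⟨ cong ((k % n) ·ℕ g ⊕_) (·ℕ-multiple-of-order (k / n)) ⟩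
      (k % n) ·ℕ g ⊕ 𝟘                          ≡⟨ ⊕-identityʳ _ ⟩
      (k % n) ·ℕ g                              ∎
      where open ≡-Reasoning

    ⊖-·ℕ : ∀ r → r ℕ.≤ n → ⊖ (r ·ℕ g) ≡ (n ∸ r) ·ℕ g
    ⊖-·ℕ r r≤n = sym (inverse-unique (trans (sym (·ℕ-distribʳ-+ r (n ∸ r) g))
                                          (trans (cong (_·ℕ g) (ℕₚ.m+[n∸m]≡n r≤n)) n·g≡𝟘)))

    ·-reduce : ∀ c → ∃ λ r → r ℕ.< n × c · g ≡ r ·ℕ g
    ·-reduce (ℤ.+ k)  = k % n , m%n<n k n , ·ℕ-mod k
    ·-reduce -[1+ k ] = (n ∸ r) % n , m%n<n (n ∸ r) n ,
      trans (cong ⊖_ (·ℕ-mod (suc k))) (trans (⊖-·ℕ r (ℕₚ.<⇒≤ (m%n<n (suc k) n))) (·ℕ-mod (n ∸ r)))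
      where r = suc k % n

    private
      ·ℕ-distinct-below-order : ∀ {a b} → a ℕ.< b → b ℕ.< n → ¬ b ·ℕ g ≡ a ·ℕ g
      ·ℕ-distinct-below-order {a} {b} a<b b<n b·g≡a·g =
        ·ℕ-nonzero (b ∸ a) (ℕₚ.m<n⇒0<n∸m a<b) (ℕₚ.≤-<-trans (ℕₚ.m∸n≤m b a) b<n)
          (x⊕y≡y⇒x≡𝟘 (trans (sym (·ℕ-distribʳ-+ (b ∸ a) a g))
                            (trans (cong (_·ℕ g) (ℕₚ.m∸n+n≡m (ℕₚ.<⇒≤ a<b))) b·g≡a·g)))

    ·ℕ-injective : ∀ a b → a ℕ.< n → b ℕ.< n → a ·ℕ g ≡ b ·ℕ g → a ≡ b
    ·ℕ-injective a b a<n b<n a·g≡b·g with ℕₚ.<-cmp a b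
    ... | tri≈ _ a≡b _ = a≡b
    ... | tri< a<b _ _ = ⊥-elim (·ℕ-distinct-below-order a<b b<n (sym a·g≡b·g))
    ... | tri> _ _ b<a = ⊥-elim (·ℕ-distinct-below-order b<a a<n a·g≡b·g)

module GroupAlgebra (𝒟 : DiscriminantForm) where
  open DiscriminantForm 𝒟
  open FinAbGroup grp
  open FinAbGroupOps grp
  open AbelianGroupProperties grp
  open FiniteSums 𝒟

  𝔢-≡ : ∀ {x y} → x ≡ y → 𝔢 𝒟 x y ≡ 1ℚ
  𝔢-≡ {x} {y} x≡y with x ≟ y
  ... | yes _   = refl
  ... | no  x≢y = ⊥-elim (x≢y x≡y)

  𝔢-≢ : ∀ {x y} → ¬ x ≡ y → 𝔢 𝒟 x y ≡ 0ℚ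
  𝔢-≢ {x} {y} x≢y with x ≟ y
  ... | yes x≡y = ⊥-elim (x≢y x≡y)
  ... | no  _   = refl

  𝔢-translate : ∀ x u y → 𝔢 𝒟 (x ⊕ u) y ≡ 𝔢 𝒟 u (⊖ x ⊕ y)
  𝔢-translate x u y with (x ⊕ u) ≟ y
  ... | yes x⊕u≡y = sym (𝔢-≡ (x⊕y≡z⇒y≡⊖x⊕z x⊕u≡y))
  ... | no  x⊕u≢y = sym (𝔢-≢ (λ u≡⊖x⊕y → x⊕u≢y (trans (cong (x ⊕_) u≡⊖x⊕y) (⊕-cancelˡ x y))))

  ↑coset≡sumFin : ∀ n g δ y → ↑coset 𝒟 n g δ y ≡ sumFin 𝒟 {n} (λ a → 𝔢 𝒟 (δ ⊕ toℕ a ·ℕ g) y)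
  ↑coset≡sumFin n g δ y = sumℕ≡sumFin n (λ a → 𝔢 𝒟 (δ ⊕ a ·ℕ g) y)

  ↑coset-translate : ∀ n g x u y →
    ↑coset 𝒟 n g (x ⊕ u) y ≡ sumFin 𝒟 {n} (λ a → 𝔢 𝒟 u ((ℤ.- ℤ.+ toℕ a) · g ⊕ (⊖ x ⊕ y)))
  ↑coset-translate n g x u y = trans (↑coset≡sumFin n g (x ⊕ u) y) (sumFin-cong {n} shift)
    where
    open ≡-Reasoning
    shift : ∀ a → 𝔢 𝒟 ((x ⊕ u) ⊕ toℕ a ·ℕ g) y ≡ 𝔢 𝒟 u ((ℤ.- ℤ.+ toℕ a) · g ⊕ (⊖ x ⊕ y))
    shift a = begin
      𝔢 𝒟 ((x ⊕ u) ⊕ t) y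
        ≡⟨ cong (λ w → 𝔢 𝒟 w y) (trans (⊕-assoc x u t) (cong (x ⊕_) (⊕-comm u t))) ⟩
      𝔢 𝒟 (x ⊕ (t ⊕ u)) y          ≡⟨ 𝔢-translate x (t ⊕ u) y ⟩
      𝔢 𝒟 (t ⊕ u) (⊖ x ⊕ y)        ≡⟨ 𝔢-translate t u (⊖ x ⊕ y) ⟩
      𝔢 𝒟 u (⊖ t ⊕ (⊖ x ⊕ y))      ≡⟨ cong (λ w → 𝔢 𝒟 u (w ⊕ (⊖ x ⊕ y))) (⊖-· (ℤ.+ toℕ a) g) ⟩
      𝔢 𝒟 u ((ℤ.- ℤ.+ toℕ a) · g ⊕ (⊖ x ⊕ y)) ∎
      where t = toℕ a ·ℕ g

  ↑H-++ : ∀ n g (cs ds : List (ℚ × D)) y → ↑H 𝒟 n g (cs ++ ds) y ≡ ↑H 𝒟 n g cs y + ↑H 𝒟 n g ds y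
  ↑H-++ n g []             ds y = sym (ℚₚ.+-identityˡ _)
  ↑H-++ n g ((c , δ) ∷ cs) ds y =
    trans (cong (_+_ (c * ↑coset 𝒟 n g δ y)) (↑H-++ n g cs ds y))
          (sym (ℚₚ.+-assoc (c * ↑coset 𝒟 n g δ y) (↑H 𝒟 n g cs y) (↑H 𝒟 n g ds y)))

  ↑H-tabulate : ∀ n g {k} (f : Fin k → ℚ × D) y →
                ↑H 𝒟 n g (tabulate f) y ≡ sumFin 𝒟 (λ i → proj₁ (f i) * ↑coset 𝒟 n g (proj₂ (f i)) y)
  ↑H-tabulate n g {zero}  f y = refl
  ↑H-tabulate n g {suc k} f y =
    cong (_+_ (proj₁ (f zero) * ↑coset 𝒟 n g (proj₂ (f zero)) y)) (↑H-tabulate n g (λ i → f (suc i)) y)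

  ↑H-concat-tabulate : ∀ n g {k} (F : Fin k → List (ℚ × D)) y →
                       ↑H 𝒟 n g (concat (tabulate F)) y ≡ sumFin 𝒟 (λ i → ↑H 𝒟 n g (F i) y)
  ↑H-concat-tabulate n g {zero}  F y = refl
  ↑H-concat-tabulate n g {suc k} F y =
    trans (↑H-++ n g (F zero) _ y) (cong (_+_ (↑H 𝒟 n g (F zero) y)) (↑H-concat-tabulate n g (λ i → F (suc i)) y))

  ⊥-⊕ : ∀ {g x y} → _∈⟨_⟩⊥ 𝒟 x g → _∈⟨_⟩⊥ 𝒟 y g → _∈⟨_⟩⊥ 𝒟 (x ⊕ y) g
  ⊥-⊕ {g} {x} {y} x⊥g y⊥g a =
    ≈ℤ-zero-if-sum (bil Q (x ⊕ y) (a · g)) (bil Q x (a · g)) (bil Q y (a · g))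
                   (bilinear x y (a · g)) (x⊥g a) (y⊥g a)

module NicelyOrthogonalSequence (𝒟 : DiscriminantForm) {m : ℕ}
  (gs : Fin (suc (suc m)) → FinAbGroup.D (DiscriminantForm.grp 𝒟))
  (nicely : NicelyOrthogonal 𝒟 (suc m) gs) where
  open DiscriminantForm 𝒟
  open FinAbGroup grp
  open FinAbGroupOps grp
  open AbelianGroupProperties grp
  open ElementOfFiniteOrder 𝒟
  open FiniteSums 𝒟
  open GroupAlgebra 𝒟
  open NicelyOrthogonal nicely

  N : ℕ
  N = suc m

  γ₀ : D
  γ₀ = gs zero

  -- As j runs through Fin m, h k j enumerates Hₖ₊₁ ∖ {0} without repetition.
  h : Fin N → Fin m → D
  h k j = suc (toℕ j) ·ℕ gs (suc k)

  h-nonzero : ∀ k j → ¬ h k j ≡ 𝟘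
  h-nonzero k j = ·ℕ-nonzero (order (suc k)) (suc (toℕ j)) ℕ.z<s (ℕ.s<s (Finₚ.toℕ<n j))

  h∉H₀ : ∀ k j a → ¬ h k j ≡ a · γ₀
  h∉H₀ k j a h≡a·γ₀ = h-nonzero k j (proj₁ (trivialInter (suc k) zero (λ ()) (ℤ.+ suc (toℕ j)) a h≡a·γ₀))

  h-injective : ∀ {k k′ j j′} → h k j ≡ h k′ j′ → k ≡ k′ × j ≡ j′
  h-injective {k} {k′} {j} {j′} h≡h′ with k Finₚ.≟ k′
  ... | yes refl = refl , Finₚ.toℕ-injective (ℕₚ.suc-injective
        (·ℕ-injective (order (suc k)) _ _ (ℕ.s<s (Finₚ.toℕ<n j)) (ℕ.s<s (Finₚ.toℕ<n j′)) h≡h′))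
  ... | no k≢k′ = ⊥-elim (h-nonzero k j (proj₁ (trivialInter (suc k) (suc k′) (λ { refl → k≢k′ refl })
                                                 (ℤ.+ suc (toℕ j)) (ℤ.+ suc (toℕ j′)) h≡h′)))

  W : D → Set
  W v = ∃[ k ] ∃[ j ] h k j ≡ v

  W? : ∀ v → Dec (W v)
  W? v = Finₚ.any? (λ k → Finₚ.any? (λ j → h k j ≟ v))

  W-translate : ∀ b v → W v → W (b · γ₀ ⊕ v)
  W-translate b v (k , j , refl) with cover k b (ℤ.+ suc (toℕ j)) (h-nonzero k j)
  ... | k′ , d , e with ·-reduce (order (suc k′)) d
  ... | zero  , _ , d·g≡𝟘 = ⊥-elim (h∉H₀ k j (ℤ.- b)
        (trans (inverse-unique (trans e d·g≡𝟘)) (⊖-· b γ₀)))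
  ... | suc r , r<N , d·g≡r·g = k′ , fromℕ< (ℕ.s<s⁻¹ r<N) ,
        trans (cong (λ t → suc t ·ℕ gs (suc k′)) (Finₚ.toℕ-fromℕ< (ℕ.s<s⁻¹ r<N))) (sym (trans e d·g≡r·g))

  𝟙W : D → ℚ
  𝟙W v = sumFin 𝒟 (λ k → sumFin 𝒟 (λ j → 𝔢 𝒟 (h k j) v))

  𝟙W-∈ : ∀ {v} → W v → 𝟙W v ≡ 1ℚ
  𝟙W-∈ (k₀ , j₀ , refl) =
    trans (sumFin-single (λ k → sumFin 𝒟 (entry k)) k₀ other-rows)
          (trans (sumFin-single (entry k₀) j₀ other-columns) (𝔢-≡ refl))
    where
    entry : Fin N → Fin m → ℚ
    entry k j = 𝔢 𝒟 (h k j) (h k₀ j₀)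
    other-rows : ∀ k → ¬ k ≡ k₀ → sumFin 𝒟 (entry k) ≡ 0ℚ
    other-rows k k≢k₀ =
      sumFin-zero (entry k) (λ j → 𝔢-≢ (λ hₖⱼ≡ → k≢k₀ (proj₁ (h-injective {k} {k₀} {j} {j₀} hₖⱼ≡))))
    other-columns : ∀ j → ¬ j ≡ j₀ → entry k₀ j ≡ 0ℚ
    other-columns j j≢j₀ = 𝔢-≢ (λ hₖⱼ≡ → j≢j₀ (proj₂ (h-injective {k₀} {k₀} {j} {j₀} hₖⱼ≡)))

  𝟙W-∉ : ∀ {v} → ¬ W v → 𝟙W v ≡ 0ℚ
  𝟙W-∉ {v} v∉W = sumFin-zero (λ k → sumFin 𝒟 (entry k)) (λ k → sumFin-zero (entry k) (λ j →
    𝔢-≢ (λ hₖⱼ≡v → v∉W (k , j , hₖⱼ≡v))))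
    where
    entry : Fin N → Fin m → ℚ
    entry k j = 𝔢 𝒟 (h k j) v

  𝟙W-translate : ∀ b v → 𝟙W (b · γ₀ ⊕ v) ≡ 𝟙W v
  𝟙W-translate b v with W? v
  ... | yes v∈W = trans (𝟙W-∈ (W-translate b v v∈W)) (sym (𝟙W-∈ v∈W))
  ... | no  v∉W = trans (𝟙W-∉ (λ w∈W → v∉W (subst W back (W-translate (ℤ.- b) _ w∈W)))) (sym (𝟙W-∉ v∉W))
    where
    back : (ℤ.- b) · γ₀ ⊕ (b · γ₀ ⊕ v) ≡ v
    back = trans (cong (_⊕ (b · γ₀ ⊕ v)) (sym (⊖-· b γ₀))) (⊖-cancelˡ (b · γ₀) v)

  module Witness (γ : D) (γ⊥ : ∀ i → _∈⟨_⟩⊥ 𝒟 γ (gs i)) where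
    Nℚ : ℚ
    Nℚ = sumFin 𝒟 {N} (λ _ → 1ℚ)

    instance
      Nℚ≢0 : ℚ.NonZero Nℚ
      Nℚ≢0 = ℚ.>-nonZero (sumFin-ones-positive m)

    ι : ℚ
    ι = 1/ Nℚ

    c₀ : ℚ
    c₀ = - (ι * ι)

    H₀-term : Fin N → Fin m → ℚ × D
    H₀-term k j = c₀ , γ ⊕ h k j

    witness : Fin (suc N) → List (ℚ × D)
    witness zero    = concat (tabulate (λ k → tabulate (H₀-term k)))
    witness (suc k) = (ι , γ) ∷ []

    witness-valid : ∀ i → ValidElt 𝒟 (gs i) (witness i)
    witness-valid zero    = concat⁺ (tabulate⁺ {f = λ k → tabulate (H₀-term k)} (λ k → tabulate⁺ (λ j →
      ⊥-⊕ (γ⊥ zero) (orth (suc k) zero (λ ()) (ℤ.+ suc (toℕ j))))))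
    witness-valid (suc k) = γ⊥ (suc k) ∷ []

    module _ (y : D) where
      open ≡-Reasoning

      z : D
      z = ⊖ γ ⊕ y

      𝔢γ≡𝔢𝟘 : 𝔢 𝒟 γ y ≡ 𝔢 𝒟 𝟘 z
      𝔢γ≡𝔢𝟘 = trans (cong (λ x → 𝔢 𝒟 x y) (sym (⊕-identityʳ γ))) (𝔢-translate γ 𝟘 y)

      ↑H₀-cosets-of-γ+W : sumFin 𝒟 (λ k → sumFin 𝒟 (λ j → ↑coset 𝒟 N γ₀ (γ ⊕ h k j) y)) ≡ Nℚ * 𝟙W z
      ↑H₀-cosets-of-γ+W = begin
        sumFin 𝒟 (λ k → sumFin 𝒟 (λ j → ↑coset 𝒟 N γ₀ (γ ⊕ h k j) y))
          ≡⟨ sumFin-cong (λ k → sumFin-cong (λ j → ↑coset-translate N γ₀ γ (h k j) y)) ⟩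
        sumFin 𝒟 (λ k → sumFin 𝒟 (λ j → sumFin 𝒟 (λ a → 𝔢 𝒟 (h k j) (t a ⊕ z))))
          ≡⟨ sumFin-cong (λ k → sumFin-swap (λ j a → 𝔢 𝒟 (h k j) (t a ⊕ z))) ⟩
        sumFin 𝒟 (λ k → sumFin 𝒟 (λ a → sumFin 𝒟 (λ j → 𝔢 𝒟 (h k j) (t a ⊕ z))))
          ≡⟨ sumFin-swap (λ k a → sumFin 𝒟 (λ j → 𝔢 𝒟 (h k j) (t a ⊕ z))) ⟩
        sumFin 𝒟 (λ a → 𝟙W (t a ⊕ z))
          ≡⟨ sumFin-cong {N} {g = λ _ → 𝟙W z} (λ a → 𝟙W-translate (ℤ.- ℤ.+ toℕ a) z) ⟩
        sumFin 𝒟 {N} (λ _ → 𝟙W z)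
          ≡⟨ sumFin-const N (𝟙W z) ⟩
        Nℚ * 𝟙W z ∎
        where
        t : Fin N → D
        t a = (ℤ.- ℤ.+ toℕ a) · γ₀

      ↑H₀-witness : ↑H 𝒟 N γ₀ (witness zero) y ≡ c₀ * (Nℚ * 𝟙W z)
      ↑H₀-witness = begin
        ↑H 𝒟 N γ₀ (witness zero) y
          ≡⟨ ↑H-concat-tabulate N γ₀ (λ k → tabulate (H₀-term k)) y ⟩
        sumFin 𝒟 (λ k → ↑H 𝒟 N γ₀ (tabulate (H₀-term k)) y)
          ≡⟨ sumFin-cong (λ k → trans (↑H-tabulate N γ₀ (H₀-term k) y)
                                      (sumFin-distribˡ-* c₀ (λ j → ↑coset 𝒟 N γ₀ (γ ⊕ h k j) y))) ⟩
        sumFin 𝒟 (λ k → c₀ * sumFin 𝒟 (λ j → ↑coset 𝒟 N γ₀ (γ ⊕ h k j) y))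
          ≡⟨ sumFin-distribˡ-* c₀ (λ k → sumFin 𝒟 (λ j → ↑coset 𝒟 N γ₀ (γ ⊕ h k j) y)) ⟩
        c₀ * sumFin 𝒟 (λ k → sumFin 𝒟 (λ j → ↑coset 𝒟 N γ₀ (γ ⊕ h k j) y))
          ≡⟨ cong (c₀ *_) ↑H₀-cosets-of-γ+W ⟩
        c₀ * (Nℚ * 𝟙W z) ∎

      ↑coset-Hₖ₊₁ : ∀ k → ↑coset 𝒟 N (gs (suc k)) γ y ≡ 𝔢 𝒟 𝟘 z + sumFin 𝒟 (λ j → 𝔢 𝒟 (h k j) z)
      ↑coset-Hₖ₊₁ k = trans (↑coset≡sumFin N (gs (suc k)) γ y)
                           (sumFin-cong {N} {g = λ a → 𝔢 𝒟 (toℕ a ·ℕ gs (suc k)) z}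
                                        (λ a → 𝔢-translate γ (toℕ a ·ℕ gs (suc k)) y))

      ↑Hₖ₊₁-witness : sumFin 𝒟 (λ k → ↑H 𝒟 N (gs (suc k)) (witness (suc k)) y) ≡ ι * (Nℚ * 𝔢 𝒟 𝟘 z + 𝟙W z)
      ↑Hₖ₊₁-witness = begin
        sumFin 𝒟 (λ k → ι * ↑coset 𝒟 N (gs (suc k)) γ y + 0ℚ)
          ≡⟨ sumFin-cong {N} {g = λ k → ι * ↑coset 𝒟 N (gs (suc k)) γ y} (λ k → ℚₚ.+-identityʳ _) ⟩
        sumFin 𝒟 (λ k → ι * ↑coset 𝒟 N (gs (suc k)) γ y)
          ≡⟨ sumFin-distribˡ-* ι (λ k → ↑coset 𝒟 N (gs (suc k)) γ y) ⟩
        ι * sumFin 𝒟 (λ k → ↑coset 𝒟 N (gs (suc k)) γ y)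
          ≡⟨ cong (ι *_) (sumFin-cong ↑coset-Hₖ₊₁) ⟩
        ι * sumFin 𝒟 (λ k → 𝔢 𝒟 𝟘 z + sumFin 𝒟 (λ j → 𝔢 𝒟 (h k j) z))
          ≡⟨ cong (ι *_) (sumFin-distrib-+ (λ _ → 𝔢 𝒟 𝟘 z) (λ k → sumFin 𝒟 (λ j → 𝔢 𝒟 (h k j) z))) ⟩
        ι * (sumFin 𝒟 {N} (λ _ → 𝔢 𝒟 𝟘 z) + 𝟙W z)
          ≡⟨ cong (λ s → ι * (s + 𝟙W z)) (sumFin-const N (𝔢 𝒟 𝟘 z)) ⟩
        ι * (Nℚ * 𝔢 𝒟 𝟘 z + 𝟙W z) ∎

      𝔢γ≡↑witness : 𝔢 𝒟 γ y ≡ sumFin 𝒟 (λ i → ↑H 𝒟 N (gs i) (witness i) y)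
      𝔢γ≡↑witness = begin
        𝔢 𝒟 γ y
          ≡⟨ 𝔢γ≡𝔢𝟘 ⟩
        𝔢 𝒟 𝟘 z
          ≡⟨ sym (cancel-witness-coefficients Nℚ ι (𝔢 𝒟 𝟘 z) (𝟙W z) (ℚₚ.*-inverseʳ Nℚ)) ⟩
        c₀ * (Nℚ * 𝟙W z) + ι * (Nℚ * 𝔢 𝒟 𝟘 z + 𝟙W z)
          ≡⟨ sym (cong₂ _+_ ↑H₀-witness ↑Hₖ₊₁-witness) ⟩
        sumFin 𝒟 (λ i → ↑H 𝒟 N (gs i) (witness i) y) ∎

lemma6p3 : (𝒟 : DiscriminantForm) (γ : FinAbGroup.D (DiscriminantForm.grp 𝒟))
    (n : ℕ) (gs : Fin (suc n) → FinAbGroup.D (DiscriminantForm.grp 𝒟)) →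
    NicelyOrthogonal 𝒟 n gs →
    (∀ i → _∈⟨_⟩⊥ 𝒟 γ (gs i)) →
    Σ (Fin (suc n) → List (ℚ × FinAbGroup.D (DiscriminantForm.grp 𝒟))) λ xs → ((∀ (i : Fin (suc n)) → ValidElt 𝒟 (gs i) (xs i)) ×
             (∀ y → 𝔢 𝒟 γ y ≡ sumFin 𝒟 (λ i → ↑H 𝒟 n (gs i) (xs i) y)))
lemma6p3 𝒟 γ zero    gs nicely γ⊥ = ⊥-elim (ℕₚ.<-irrefl refl (proj₁ (NicelyOrthogonal.order nicely zero)))
lemma6p3 𝒟 γ (suc m) gs nicely γ⊥ = witness , witness-valid , 𝔢γ≡↑witness
  where open NicelyOrthogonalSequence.Witness 𝒟 gs nicely γ γ⊥
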